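{- Let $G=(V,E)$ be a graph (not necessarily bipartite) in which every node has a strict preference order over its neighbours, and let $M$ be a matching in $G$. Then $M$ is strongly dominant in $G$ if and only if there exists $\vec\alpha\in\mathbb{R}^V$ with $\sum_{u\in V}\alpha_u=0$, $\alpha_u+\alpha_v\ge\mathsf{wt}_M(u,v)$ for every $(u,v)\in E$, $\alpha_u\ge\mathsf{wt}_M(u,u)$ for every $u\in V$, and moreover $\alpha_u\in\{1,-1\}$ for every node $u$ matched in $M$ and $\alpha_u=0$ for every node $u$ unmatched in $M$.
   Context: $M(u)$ is the partner of $u$ in $M$; an unmatched node prefers any neighbour to being unmatched. For $(u,v)\in E\setminus M$, the label of $(u,v)$ at $u$ is $+$ if $u$ is unmatched in $M$ or prefers $v$ to $M(u)$, and $-$ otherwise; $(u,v)$ is a $(+,+)$ edge if both labels are $+$ and a $(-,-)$ edge if both are $-$. Define $\mathsf{wt}_M(u,v)=2$ if $(u,v)$ is $(+,+)$, $-2$ if $(u,v)$ is $(-,-)$, and $0$ otherwise (in particular for edges of $M$); $\mathsf{wt}_M(u,u)=0$ if $u$ is unmatched in $M$ and $-1$ otherwise. A matching $M$ is strongly dominant in $G$ if there is a partition $(L,R)$ of $V$ such that (i) every edge of $M$ has one endpoint in $L$ and the other in $R$, (ii) every node of $R$ is matched in $M$, (iii) every $(+,+)$ edge has both endpoints in $R$, and (iv) every edge of $G$ with both endpoints in $L$ is a $(-,-)$ edge. -}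

module Defs where

open import Data.Nat using (ℕ; _<_; _<ᵇ_)
open import Data.Fin using (Fin; zero; suc)
open import Data.Fin.Properties using (_≟_)
open import Data.Bool using (Bool; true; false; _∧_; not; if_then_else_)
open import Data.Maybe using (Maybe; just; nothing)
open import Data.Integer using (ℤ; +_; -_; -[1+_]) renaming (_+_ to _+ℤ_)
open import Data.Product using (Σ; _×_; _,_)
open import Data.Sum using (_⊎_)
open import Relation.Nullary using (¬_; does)
open import Relation.Binary.PropositionalEquality using (_≡_; _≢_)

record PrefGraph (n : ℕ) : Set where
  field
    adj      : Fin n → Fin n → Bool
    adj-sym  : ∀ u v → adj u v ≡ adj v u
    adj-irr  : ∀ u → adj u u ≡ false
    rank     : Fin n → Fin n → ℕ
    rank-inj : ∀ u v w → adj u v ≡ true → adj u w ≡ true →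
               rank u v ≡ rank u w → v ≡ w

Prefers : ∀ {n} → PrefGraph n → Fin n → Fin n → Fin n → Set
Prefers G u v w = PrefGraph.rank G u v < PrefGraph.rank G u w

-- A matching, given by the partner function M(u) (nothing = unmatched).
record Matching {n : ℕ} (G : PrefGraph n) : Set where
  field
    mate     : Fin n → Maybe (Fin n)
    mate-sym : ∀ u v → mate u ≡ just v → mate v ≡ just u
    mate-adj : ∀ u v → mate u ≡ just v → PrefGraph.adj G u v ≡ true

module _ {n : ℕ} {G : PrefGraph n} (M : Matching G) where
  open PrefGraph G
  open Matching M

  Matched : Fin n → Set
  Matched u = Σ (Fin n) λ v → mate u ≡ just v

  Unmatched : Fin n → Set
  Unmatched u = mate u ≡ nothing

  inMᵇ : Fin n → Fin n → Bool
  inMᵇ u v with mate u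
  ... | nothing = false
  ... | just w  = does (w ≟ v)

  -- label of (u,v) at u is + : u unmatched, or u prefers v to M(u)
  plusᵇ : Fin n → Fin n → Bool
  plusᵇ u v with mate u
  ... | nothing = true
  ... | just w  = rank u v <ᵇ rank u w

  PPᵇ : Fin n → Fin n → Bool
  PPᵇ u v = adj u v ∧ not (inMᵇ u v) ∧ plusᵇ u v ∧ plusᵇ v u

  MMᵇ : Fin n → Fin n → Bool
  MMᵇ u v = adj u v ∧ not (inMᵇ u v) ∧ not (plusᵇ u v) ∧ not (plusᵇ v u)

  wt : Fin n → Fin n → ℤ
  wt u v = if PPᵇ u v then + 2 else (if MMᵇ u v then - (+ 2) else + 0)

  wtSelf : Fin n → ℤ
  wtSelf u with mate u
  ... | nothing = + 0
  ... | just _  = -[1+ 0 ]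

  -- strongly dominant; the partition (L,R) is given by inL : Fin n → Bool
  -- (inL u ≡ true means u ∈ L, inL u ≡ false means u ∈ R)
  StronglyDominant : Set
  StronglyDominant = Σ (Fin n → Bool) λ inL →
      (∀ u v → mate u ≡ just v → inL u ≢ inL v)
    × (∀ u → inL u ≡ false → Matched u)
    × (∀ u v → PPᵇ u v ≡ true → (inL u ≡ false × inL v ≡ false))
    × (∀ u v → adj u v ≡ true → inL u ≡ true → inL v ≡ true → MMᵇ u v ≡ true)

sumFin : ∀ {n} → (Fin n → ℤ) → ℤ
sumFin {Data.Nat.zero}  f = + 0
sumFin {Data.Nat.suc n} f = f zero +ℤ sumFin (λ i → f (suc i))

module Submission where

-- Given (L, R), take α = 1 on R, -1 on the matched nodes of L and 0 off M.  Every edge of M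
-- joins L to R, so α sums to 0 over each edge of M and hence over V; the edge constraints
-- follow from (iii) and (iv).  Conversely, pair every node with its partner, an unmatched node
-- with itself.  Each pair sum α u + α (M u) is at least wt_M(u, M u) = 0, resp. equals 2 α u = 0,
-- and the pair sums add up to 2 Σ α = 0, so all of them vanish: every edge of M joins a node
-- with α = 1 to one with α = -1.  Then R = {α = 1} and L = {α ≤ 0} satisfy (i)-(iv): a (+,+)
-- edge needs α u + α v ≥ 2, and on an edge inside L, α u + α v ≤ -1 forces wt = -2, because
-- two adjacent unmatched nodes would form a (+,+) edge.

open import Defs
open import Data.Nat using (ℕ)
open import Data.Fin using (Fin)
open import Data.Bool using (true)
open import Data.Integer using (ℤ; +_; -[1+_]; _+_; _≤_)
open import Data.Product using (Σ; _×_)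
open import Data.Sum using (_⊎_)
open import Function.Bundles using (_⇔_)
open import Relation.Binary.PropositionalEquality using (_≡_)

import Algebra.Properties.CommutativeMonoid.Sum as CommutativeMonoidSum
open import Data.Bool using (Bool; false; not; _∧_; T; if_then_else_)
open import Data.Fin using (zero; suc)
open import Data.Fin.Permutation using (permutation)
open import Data.Fin.Properties using (_≟_)
open import Data.Integer using (-_; +≤+; -≤+; 0ℤ; 1ℤ; -1ℤ; _≤ᵇ_)
open import Data.Integer.Properties
  using (+-0-commutativeMonoid; +-comm; +-identityʳ; +-mono-≤; +-monoʳ-≤;
         ≤-refl; ≤-trans; ≤-antisym; ≤-reflexive; ≤∧≮⇒≡; i<j⇒i≤pred[j]; ≤ᵇ⇒≤)
open import Data.Maybe using (just; nothing; fromMaybe)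
open import Data.Nat using (zero; suc; z≤n; s≤s)
open import Data.Product using (_,_; proj₁; proj₂; map)
open import Data.Sum using (inj₁; inj₂)
open import Data.Unit using (tt)
open import Function.Bundles using (mk⇔)
open import Relation.Binary.PropositionalEquality
  using (_≢_; refl; sym; trans; cong; cong₂; subst)
open import Relation.Nullary using (contradiction)
open import Relation.Nullary.Decidable using (dec-true)

private
  variable
    n : ℕ
    a b : ℤ

IsUnit : ℤ → Set
IsUnit a = a ≡ 1ℤ ⊎ a ≡ -1ℤ

i+i≡0⇒i≡0 : ∀ i → i + i ≡ 0ℤ → i ≡ 0ℤ
i+i≡0⇒i≡0 (+ 0)     _ = refl
i+i≡0⇒i≡0 (+ suc _) ()
i+i≡0⇒i≡0 -[1+ _ ]  ()

0≤i∧0≤j∧i+j≡0⇒i≡0 : 0ℤ ≤ a → 0ℤ ≤ b → a + b ≡ 0ℤ → a ≡ 0ℤ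
0≤i∧0≤j∧i+j≡0⇒i≡0 {a} 0≤a 0≤b a+b≡0 = ≤-antisym a≤0 0≤a
  where
  a≤0 : a ≤ 0ℤ
  a≤0 = ≤-trans (≤-reflexive (sym (+-identityʳ a)))
                (≤-trans (+-monoʳ-≤ a 0≤b) (≤-reflexive a+b≡0))

i≤1∧j≤1∧2≤i+j⇒i≡1 : a ≤ 1ℤ → b ≤ 1ℤ → + 2 ≤ a + b → a ≡ 1ℤ
i≤1∧j≤1∧2≤i+j⇒i≡1 a≤1 b≤1 2≤a+b = ≤∧≮⇒≡ a≤1 λ a<1 →
  contradiction (≤-trans 2≤a+b (+-mono-≤ (i<j⇒i≤pred[j] a<1) b≤1)) λ { (+≤+ (s≤s ())) }

unit-sum≡0⇒≤ᵇ0-differ : IsUnit a → IsUnit b → a + b ≡ 0ℤ → (a ≤ᵇ 0ℤ) ≢ (b ≤ᵇ 0ℤ)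
unit-sum≡0⇒≤ᵇ0-differ (inj₁ refl) (inj₁ refl) ()
unit-sum≡0⇒≤ᵇ0-differ (inj₁ refl) (inj₂ refl) _ ()
unit-sum≡0⇒≤ᵇ0-differ (inj₂ refl) (inj₁ refl) _ ()
unit-sum≡0⇒≤ᵇ0-differ (inj₂ refl) (inj₂ refl) ()

unit≤0⇒≡-1 : IsUnit a → a ≤ 0ℤ → a ≡ -1ℤ
unit≤0⇒≡-1 (inj₁ refl) (+≤+ ())
unit≤0⇒≡-1 (inj₂ a≡-1) _ = a≡-1

module ℤSum = CommutativeMonoidSum +-0-commutativeMonoid

sumFin≡sum : (f : Fin n → ℤ) → sumFin f ≡ ℤSum.sum f
sumFin≡sum {zero}  f = refl
sumFin≡sum {suc n} f = cong (λ s → f zero + s) (sumFin≡sum (λ i → f (suc i)))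

sumFin-+ : (f g : Fin n → ℤ) → sumFin (λ u → f u + g u) ≡ sumFin f + sumFin g
sumFin-+ f g = trans (sumFin≡sum (λ u → f u + g u)) (trans (ℤSum.∑-distrib-+ f g)
  (sym (cong₂ _+_ (sumFin≡sum f) (sumFin≡sum g))))

sumFin-involution : (f : Fin n → ℤ) {σ : Fin n → Fin n} → (∀ u → σ (σ u) ≡ u) →
                    sumFin (λ u → f (σ u)) ≡ sumFin f
sumFin-involution f {σ} σ-inv = trans (sumFin≡sum (λ u → f (σ u))) (trans
  (sym (ℤSum.sum-permute f (permutation σ σ σ-inv σ-inv))) (sym (sumFin≡sum f)))

sumFin-zero : (f : Fin n → ℤ) → (∀ u → f u ≡ 0ℤ) → sumFin f ≡ 0ℤ
sumFin-zero {zero}  f f≡0 = refl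
sumFin-zero {suc n} f f≡0 = cong₂ _+_ (f≡0 zero) (sumFin-zero _ (λ i → f≡0 (suc i)))

sumFin-nonneg : (f : Fin n → ℤ) → (∀ u → 0ℤ ≤ f u) → 0ℤ ≤ sumFin f
sumFin-nonneg {zero}  f 0≤f = ≤-refl
sumFin-nonneg {suc n} f 0≤f = +-mono-≤ (0≤f zero) (sumFin-nonneg _ (λ i → 0≤f (suc i)))

sumFin-nonneg≡0⇒≡0 : (f : Fin n → ℤ) → (∀ u → 0ℤ ≤ f u) → sumFin f ≡ 0ℤ → ∀ u → f u ≡ 0ℤ
sumFin-nonneg≡0⇒≡0 {suc n} f 0≤f Σf≡0 zero =
  0≤i∧0≤j∧i+j≡0⇒i≡0 (0≤f zero) (sumFin-nonneg _ (λ i → 0≤f (suc i))) Σf≡0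
sumFin-nonneg≡0⇒≡0 {suc n} f 0≤f Σf≡0 (suc u) =
  sumFin-nonneg≡0⇒≡0 _ (λ i → 0≤f (suc i)) Σtail≡0 u
  where
  Σtail≡0 : sumFin (λ i → f (suc i)) ≡ 0ℤ
  Σtail≡0 = 0≤i∧0≤j∧i+j≡0⇒i≡0 (sumFin-nonneg _ (λ i → 0≤f (suc i))) (0≤f zero)
                              (trans (+-comm _ (f zero)) Σf≡0)

module _ {σ : Fin n → Fin n} (σ-involutive : ∀ u → σ (σ u) ≡ u) (f : Fin n → ℤ) where

  sumFin-pairs : sumFin (λ u → f u + f (σ u)) ≡ sumFin f + sumFin f
  sumFin-pairs = trans (sumFin-+ f (λ u → f (σ u)))
                       (cong (_+_ (sumFin f)) (sumFin-involution f σ-involutive))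

  pairs≡0⇒sumFin≡0 : (∀ u → f u + f (σ u) ≡ 0ℤ) → sumFin f ≡ 0ℤ
  pairs≡0⇒sumFin≡0 pairs≡0 =
    i+i≡0⇒i≡0 _ (trans (sym sumFin-pairs) (sumFin-zero _ pairs≡0))

  sumFin≡0⇒pairs≡0 : (∀ u → 0ℤ ≤ f u + f (σ u)) → sumFin f ≡ 0ℤ → ∀ u → f u + f (σ u) ≡ 0ℤ
  sumFin≡0⇒pairs≡0 0≤pairs Σf≡0 =
    sumFin-nonneg≡0⇒≡0 _ 0≤pairs (trans sumFin-pairs (cong₂ _+_ Σf≡0 Σf≡0))

module _ {G : PrefGraph n} (M : Matching G) where
  open PrefGraph G
  open Matching M

  private
    variable
      u v : Fin n

  partner : Fin n → Fin n
  partner u = fromMaybe u (mate u)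

  partner-involutive : ∀ u → partner (partner u) ≡ u
  partner-involutive u with mate u in eu
  ... | nothing rewrite eu = refl
  ... | just v  rewrite mate-sym u v eu = refl

  partner-matched : mate u ≡ just v → partner u ≡ v
  partner-matched eu rewrite eu = refl

  PP⇒adj : PPᵇ M u v ≡ true → adj u v ≡ true
  PP⇒adj {u} {v} = ∧-true⇒ˡ (adj u v) _
    where
    ∧-true⇒ˡ : ∀ a b → a ∧ b ≡ true → a ≡ true
    ∧-true⇒ˡ true _ _ = refl

  MM⇒¬PP : MMᵇ M u v ≡ true → PPᵇ M u v ≡ false
  MM⇒¬PP {u} {v} = opposite-labels (adj u v) (not (inMᵇ M u v)) (plusᵇ M u v) (plusᵇ M v u)
    where
    opposite-labels : ∀ a b c d → a ∧ b ∧ not c ∧ not d ≡ true → a ∧ b ∧ c ∧ d ≡ false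
    opposite-labels true  true  false false _ = refl
    opposite-labels true  true  false true  ()
    opposite-labels true  true  true  _     ()
    opposite-labels true  false _     _     ()
    opposite-labels false _     _     _     ()

  wt-PP : PPᵇ M u v ≡ true → wt M u v ≡ + 2
  wt-PP pp rewrite pp = refl

  wt-MM : MMᵇ M u v ≡ true → wt M u v ≡ - + 2
  wt-MM mm rewrite MM⇒¬PP mm | mm = refl

  wt≤2 : ∀ u v → wt M u v ≤ + 2
  wt≤2 u v with PPᵇ M u v | MMᵇ M u v
  ... | true  | _     = ≤-refl
  ... | false | true  = -≤+
  ... | false | false = +≤+ z≤n

  wt≤0 : PPᵇ M u v ≢ true → wt M u v ≤ 0ℤ
  wt≤0 {u} {v} ¬pp with PPᵇ M u v | MMᵇ M u v
  ... | true  | _     = contradiction refl ¬pp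
  ... | false | true  = -≤+
  ... | false | false = ≤-refl

  wt≤-1⇒MM : wt M u v ≤ -1ℤ → MMᵇ M u v ≡ true
  wt≤-1⇒MM {u} {v} wt≤-1 with PPᵇ M u v | MMᵇ M u v | wt≤-1
  ... | false | true | _ = refl
  ... | true  | _    | ()
  ... | false | false | ()

  inM-mate : mate u ≡ just v → inMᵇ M u v ≡ true
  inM-mate {u} {v} eu rewrite eu = dec-true (v ≟ v) refl

  wt-mate : mate u ≡ just v → wt M u v ≡ 0ℤ
  wt-mate {u} {v} eu rewrite mate-adj u v eu | inM-mate eu = refl

  unmatched-edge-PP : mate u ≡ nothing → mate v ≡ nothing → adj u v ≡ true → PPᵇ M u v ≡ true
  unmatched-edge-PP eu ev uv rewrite uv | eu | ev = refl

  Witness : Set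
  Witness = Σ (Fin n → ℤ) λ α →
      (sumFin α ≡ 0ℤ)
    × (∀ u v → adj u v ≡ true → wt M u v ≤ α u + α v)
    × (∀ u → wtSelf M u ≤ α u)
    × (∀ u → Matched M u → IsUnit (α u))
    × (∀ u → Unmatched M u → α u ≡ 0ℤ)

  partitionPotential : (Fin n → Bool) → Fin n → ℤ
  partitionPotential inL u with mate u
  ... | nothing = 0ℤ
  ... | just _  = if inL u then -1ℤ else 1ℤ

  stronglyDominant⇒witness : StronglyDominant M → Witness
  stronglyDominant⇒witness (inL , across , R-matched , PP⊆R , L-independent) =
    α , pairs≡0⇒sumFin≡0 partner-involutive α pair≡0 , edge , self , unit , unmatched
    where
    α : Fin n → ℤ
    α = partitionPotential inL

    -1≤α : ∀ u → -1ℤ ≤ α u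
    -1≤α u with mate u
    ... | nothing = -≤+
    ... | just _ with inL u
    ... | true  = ≤-refl
    ... | false = -≤+

    R⇒α≡1 : inL u ≡ false → α u ≡ 1ℤ
    R⇒α≡1 {u} u∈R with R-matched u u∈R
    ... | _ , eu rewrite eu | u∈R = refl

    PP⇒∉L : PPᵇ M u v ≡ true → inL u ≢ true × inL v ≢ true
    PP⇒∉L {u} {v} pp = map R⇒∉L R⇒∉L (PP⊆R u v pp)
      where
      R⇒∉L : ∀ {b} → b ≡ false → b ≢ true
      R⇒∉L refl ()

    pair≡0 : ∀ u → α u + α (partner u) ≡ 0ℤ
    pair≡0 u with mate u in eu
    ... | nothing rewrite eu = refl
    ... | just v rewrite mate-sym u v eu with inL u | inL v | across u v eu
    ... | true  | false | _   = refl
    ... | false | true  | _   = refl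
    ... | true  | true  | u≁v = contradiction refl u≁v
    ... | false | false | u≁v = contradiction refl u≁v

    edge : ∀ u v → adj u v ≡ true → wt M u v ≤ α u + α v
    edge u v uv with inL u in u∈L | inL v in v∈L
    ... | true  | true  = ≤-trans (≤-reflexive (wt-MM (L-independent u v uv u∈L v∈L)))
                                  (+-mono-≤ (-1≤α u) (-1≤α v))
    ... | true  | false = ≤-trans (wt≤0 (λ pp → proj₁ (PP⇒∉L pp) u∈L))
                                  (+-mono-≤ (-1≤α u) (≤-reflexive (sym (R⇒α≡1 v∈L))))
    ... | false | true  = ≤-trans (wt≤0 (λ pp → proj₂ (PP⇒∉L pp) v∈L))
                                  (+-mono-≤ (≤-reflexive (sym (R⇒α≡1 u∈L))) (-1≤α v))
    ... | false | false = ≤-trans (wt≤2 u v)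
                                  (≤-reflexive (sym (cong₂ _+_ (R⇒α≡1 u∈L) (R⇒α≡1 v∈L))))

    self : ∀ u → wtSelf M u ≤ α u
    self u with mate u
    ... | nothing = ≤-refl
    ... | just _ with inL u
    ... | true  = ≤-refl
    ... | false = -≤+

    unit : ∀ u → Matched M u → IsUnit (α u)
    unit u (_ , eu) rewrite eu with inL u
    ... | true  = inj₂ refl
    ... | false = inj₁ refl

    unmatched : ∀ u → Unmatched M u → α u ≡ 0ℤ
    unmatched u eu rewrite eu = refl

  -- The bound α u ≥ wt_M(u, u) is implied by the prescribed values of α and is not needed.
  witness⇒stronglyDominant : Witness → StronglyDominant M
  witness⇒stronglyDominant (α , Σα≡0 , edge , _ , unit , unmatched) =
    inL , across , R-matched , PP⊆R , L-independent
    where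
    inL : Fin n → Bool
    inL u = α u ≤ᵇ 0ℤ

    L⇒α≤0 : inL u ≡ true → α u ≤ 0ℤ
    L⇒α≤0 u∈L = ≤ᵇ⇒≤ (subst T (sym u∈L) tt)

    α≤1 : ∀ u → α u ≤ 1ℤ
    α≤1 u with mate u in eu
    ... | nothing = ≤-trans (≤-reflexive (unmatched u eu)) (+≤+ z≤n)
    ... | just v with unit u (v , eu)
    ... | inj₁ α≡1  = ≤-reflexive α≡1
    ... | inj₂ α≡-1 = ≤-trans (≤-reflexive α≡-1) -≤+

    pair≡0 : ∀ u → α u + α (partner u) ≡ 0ℤ
    pair≡0 = sumFin≡0⇒pairs≡0 partner-involutive α 0≤pair Σα≡0
      where
      0≤pair : ∀ u → 0ℤ ≤ α u + α (partner u)
      0≤pair u with mate u in eu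
      ... | nothing rewrite unmatched u eu = ≤-refl
      ... | just v  = ≤-trans (≤-reflexive (sym (wt-mate eu))) (edge u v (mate-adj u v eu))

    across : ∀ u v → mate u ≡ just v → inL u ≢ inL v
    across u v eu = unit-sum≡0⇒≤ᵇ0-differ (unit u (v , eu)) (unit v (u , mate-sym u v eu))
      (trans (cong (λ w → α u + α w) (sym (partner-matched eu))) (pair≡0 u))

    R-matched : ∀ u → inL u ≡ false → Matched M u
    R-matched u u∈R with mate u in eu
    ... | just v  = v , refl
    ... | nothing = contradiction (trans (sym (cong (_≤ᵇ 0ℤ) (unmatched u eu))) u∈R) λ ()

    PP⊆R : ∀ u v → PPᵇ M u v ≡ true → inL u ≡ false × inL v ≡ false
    PP⊆R u v pp = map (cong (_≤ᵇ 0ℤ)) (cong (_≤ᵇ 0ℤ))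
      ( i≤1∧j≤1∧2≤i+j⇒i≡1 (α≤1 u) (α≤1 v) 2≤α
      , i≤1∧j≤1∧2≤i+j⇒i≡1 (α≤1 v) (α≤1 u) (≤-trans 2≤α (≤-reflexive (+-comm (α u) (α v)))))
      where
      2≤α : + 2 ≤ α u + α v
      2≤α = ≤-trans (≤-reflexive (sym (wt-PP pp))) (edge u v (PP⇒adj pp))

    L∩matched⇒α≡-1 : inL u ≡ true → Matched M u → α u ≡ -1ℤ
    L∩matched⇒α≡-1 {u} u∈L m = unit≤0⇒≡-1 (unit u m) (L⇒α≤0 u∈L)

    L-independent : ∀ u v → adj u v ≡ true → inL u ≡ true → inL v ≡ true → MMᵇ M u v ≡ true
    L-independent u v uv u∈L v∈L = wt≤-1⇒MM (≤-trans (edge u v uv) α≤-1)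
      where
      α≤-1 : α u + α v ≤ -1ℤ
      α≤-1 with mate u in eu | mate v in ev
      ... | nothing | nothing =
        contradiction (trans (sym u∈L) (proj₁ (PP⊆R u v (unmatched-edge-PP eu ev uv)))) λ ()
      ... | just x  | _       =
        +-mono-≤ (≤-reflexive (L∩matched⇒α≡-1 u∈L (x , eu))) (L⇒α≤0 v∈L)
      ... | nothing | just y  =
        +-mono-≤ (L⇒α≤0 u∈L) (≤-reflexive (L∩matched⇒α≡-1 v∈L (y , ev)))

theorem5 : {n : ℕ} (G : PrefGraph n) (M : Matching G) →
    StronglyDominant M ⇔
    Σ (Fin n → ℤ) (λ α →
        (sumFin α ≡ + 0)
      × (∀ u v → PrefGraph.adj G u v ≡ true → wt M u v ≤ α u + α v)
      × (∀ u → wtSelf M u ≤ α u)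
      × (∀ u → Matched M u → (α u ≡ + 1 ⊎ α u ≡ -[1+ 0 ]))
      × (∀ u → Unmatched M u → α u ≡ + 0))
theorem5 G M = mk⇔ (stronglyDominant⇒witness M) (witness⇒stronglyDominant M)
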